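{- Let $\Gamma=\{\Lambda_i\}_{i\in I}\subseteq S_c[X]$, where $\Lambda_i=\overline{(\alpha_i,N_i)}$ and $\alpha_i\in S_c[X_{N_i}]$. Let $\Lambda=\overline{(\beta,N)}$ with $\beta\in S_c[X_N]$. If $\Gamma\vdash\Lambda$, then $\bigcap\limits_{i\in I}A_{\alpha_i}\subseteq A_{\beta}$.
   Context: An idempotent complement (I-C) semiring is a commutative semiring $(S,\circ,\cdot,\theta,1)$ in which every $s$ has a complement $s^c$ with $s\cdot s^c=\theta$, $s\circ s^c=1$, $s\cdot s=s$, $s\circ s=s$. Let $X=\{x_1,x_2,\cdots\}$ be a countable set, $X_N=\{x_1,\dots,x_N\}$, and $S_c[X_N]$ the free I-C semiring generated by $X_N$. $S_c[X]$ is the free I-C semiring generated by $X$, realized as the direct limit of the $S_c[X_N]$ under the natural embeddings $f_{NM}:S_c[X_N]\to S_c[X_M]$ ($N\le M$); its elements are classes $\overline{(\alpha,N)}$ with $\alpha\in S_c[X_N]$. For $\Gamma\subseteq S_c[X]$ and $\beta\in S_c[X]$, $\Gamma\vdash\beta$ means $\beta\equiv_\Gamma 1$, where $\equiv_\Gamma$ is the congruence on $S_c[X]$ generated by $\{(\alpha,1)\mid\alpha\in\Gamma\}$. $A_i$ (resp. $A_i^c$) is the set of all $k\in\mathbb{N}$ whose binary digit of weight $2^{i-1}$ is $1$ (resp. $0$). For $\alpha=U_1\circ\cdots\circ U_m\in S_c[X_N]$ with $U_i=x_1^{i_1}\cdots x_N^{i_N}$, where $x_l^h$ denotes $1,x_l,x_l^c$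 for $h=0,1,c$, set $A_\alpha=\bigcup_{i=1}^m\bigcap_{j=1}^N A_j^{i_j}$ with $A_j^{i_j}=\mathbb{N},A_j,A_j^c$ for $i_j=0,1,c$. -}

module Defs where

open import Data.Nat using (ℕ; zero; suc; ⌊_/2⌋)
open import Data.Bool using (Bool; true; false; T)
open import Data.Fin using (Fin; toℕ)
open import Data.Vec using (Vec; []; _∷_; lookup)
open import Data.List using (List; []; _∷_)
open import Data.Product using (Σ; _×_)
open import Data.Sum using (_⊎_)
open import Data.Unit using (⊤)
open import Data.Empty using (⊥)
open import Relation.Binary.PropositionalEquality using (_≡_)

-- Terms in the signature of I-C semirings (∘, ·, θ, 1, complement)
-- over the countable generating set X = {x₁, x₂, ...}.
-- Convention: var j stands for the paper's x_{j+1}.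

infixl 6 _⊕_
infixl 7 _⊙_

data Term : Set where
  var : ℕ → Term
  θ   : Term
  𝟙   : Term
  _⊕_ : Term → Term → Term
  _⊙_ : Term → Term → Term
  _ᶜ  : Term → Term          -- complement (unique, hence an operation)

-- Γ-congruence: the least congruence on terms containing the axioms of
-- I-C semirings (terms modulo the axioms alone form the free I-C semiring
-- S_c[X]) together with the pairs (Λ_i , 1) for Λ_i ∈ Γ.
-- Hence  Γ ∣ a ≈ b  is exactly  a ≡_Γ b  on S_c[X].

infix 4 _∣_≈_

data _∣_≈_ {I : Set} (Γ : I → Term) : Term → Term → Set where
  refl≈  : ∀ {a} → Γ ∣ a ≈ a
  sym≈   : ∀ {a b} → Γ ∣ a ≈ b → Γ ∣ b ≈ a
  trans≈ : ∀ {a b c} → Γ ∣ a ≈ b → Γ ∣ b ≈ c → Γ ∣ a ≈ c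
  ⊕-cong : ∀ {a b c d} → Γ ∣ a ≈ b → Γ ∣ c ≈ d → Γ ∣ a ⊕ c ≈ b ⊕ d
  ⊙-cong : ∀ {a b c d} → Γ ∣ a ≈ b → Γ ∣ c ≈ d → Γ ∣ a ⊙ c ≈ b ⊙ d
  ᶜ-cong : ∀ {a b} → Γ ∣ a ≈ b → Γ ∣ a ᶜ ≈ b ᶜ
  ⊕-assoc : ∀ a b c → Γ ∣ (a ⊕ b) ⊕ c ≈ a ⊕ (b ⊕ c)
  ⊕-comm  : ∀ a b → Γ ∣ a ⊕ b ≈ b ⊕ a
  ⊕-idˡ   : ∀ a → Γ ∣ θ ⊕ a ≈ a
  ⊙-assoc : ∀ a b c → Γ ∣ (a ⊙ b) ⊙ c ≈ a ⊙ (b ⊙ c)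
  ⊙-comm  : ∀ a b → Γ ∣ a ⊙ b ≈ b ⊙ a
  ⊙-idˡ   : ∀ a → Γ ∣ 𝟙 ⊙ a ≈ a
  distribˡ : ∀ a b c → Γ ∣ a ⊙ (b ⊕ c) ≈ (a ⊙ b) ⊕ (a ⊙ c)
  zeroˡ   : ∀ a → Γ ∣ θ ⊙ a ≈ θ
  ⊙-compl : ∀ a → Γ ∣ a ⊙ (a ᶜ) ≈ θ
  ⊕-compl : ∀ a → Γ ∣ a ⊕ (a ᶜ) ≈ 𝟙
  ⊙-idem  : ∀ a → Γ ∣ a ⊙ a ≈ a
  ⊕-idem  : ∀ a → Γ ∣ a ⊕ a ≈ a
  hyp     : ∀ i → Γ ∣ Γ i ≈ 𝟙

infix 3 _⊢_
_⊢_ : {I : Set} → (I → Term) → Term → Set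
Γ ⊢ β = Γ ∣ β ≈ 𝟙

-- Elements of S_c[X_N] in the form U₁ ∘ ⋯ ∘ U_m with
-- U_i = x₁^{i₁} ⋯ x_N^{i_N}, exponents h ∈ {0, 1, c}.

data Exp : Set where
  e0 e1 ec : Exp

Monomial : ℕ → Set
Monomial N = Vec Exp N

Poly : ℕ → Set
Poly N = List (Monomial N)

pow : ℕ → Exp → Term
pow l e0 = 𝟙
pow l e1 = var l
pow l ec = var l ᶜ

monoTerm : ∀ {N} → ℕ → Monomial N → Term
monoTerm off []       = 𝟙
monoTerm off (h ∷ hs) = pow off h ⊙ monoTerm (suc off) hs

-- the class  \overline{(α , N)}  ∈ S_c[X]  (natural embedding into the limit)
⟦_⟧ : ∀ {N} → Poly N → Term
⟦ [] ⟧     = θ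
⟦ U ∷ Us ⟧ = monoTerm 0 U ⊕ ⟦ Us ⟧

odd : ℕ → Bool
odd zero          = false
odd (suc zero)    = true
odd (suc (suc n)) = odd n

digit : ℕ → ℕ → Bool
digit k zero    = odd k
digit k (suc j) = digit ⌊ k /2⌋ j

-- k ∈ A_{j+1}  (digit of weight 2^j is 1);  var j = x_{j+1}
inA : ℕ → ℕ → Set
inA j k = digit k j ≡ true

inAc : ℕ → ℕ → Set
inAc j k = digit k j ≡ false

inAexp : ℕ → Exp → ℕ → Set
inAexp l e0 k = ⊤
inAexp l e1 k = inA l k
inAexp l ec k = inAc l k

inMono : ∀ {N} → ℕ → Monomial N → ℕ → Set
inMono off []       k = ⊤
inMono off (h ∷ hs) k = inAexp off h k × inMono (suc off) hs k

inAα : ∀ {N} → Poly N → ℕ → Set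
inAα []       k = ⊥
inAα (U ∷ Us) k = inMono 0 U k ⊎ inAα Us k

{-# OPTIONS --safe #-}
module Submission where

-- Every Boolean valuation of the variables is a homomorphism from the term
-- algebra to the two-element I-C semiring, so a valuation under which all of
-- Γ is true makes everything Γ-congruent to 1 true. A point k ∈ ℕ is the
-- valuation sending x_{j+1} to the binary digit of k of weight 2^j, and under
-- it α evaluates to true exactly when k ∈ A_α.

open import Defs
open import Data.Nat using (ℕ)
open import Data.Bool using (Bool; true; false; _∧_; _∨_; not; T)
open import Data.Bool.Properties
  using ( ∨-assoc; ∨-comm; ∨-inverseʳ; ∨-idem; ∧-assoc; ∧-comm; ∧-inverseʳ; ∧-idem
        ; ∧-distribˡ-∨; T-≡; T-not-≡; T-∧; T-∨ )
open import Data.Unit using (tt)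
open import Data.Product.Function.NonDependent.Propositional using (_×-⇔_)
open import Data.Sum.Function.Propositional using (_⊎-⇔_)
open import Data.Vec using ([]; _∷_)
open import Data.List using ([]; _∷_)
open import Function.Bundles using (_⇔_; mk⇔; Equivalence)
open import Function.Construct.Composition using (_⇔-∘_)
open import Relation.Binary.PropositionalEquality
  using (_≡_; refl; sym; trans; cong; cong₂; subst)

eval : (ℕ → Bool) → Term → Bool
eval ρ (var j) = ρ j
eval ρ θ       = false
eval ρ 𝟙       = true
eval ρ (a ⊕ b) = eval ρ a ∨ eval ρ b
eval ρ (a ⊙ b) = eval ρ a ∧ eval ρ b
eval ρ (a ᶜ)   = not (eval ρ a)

module _ {I : Set} {Γ : I → Term} (ρ : ℕ → Bool) (ρ⊨Γ : ∀ i → T (eval ρ (Γ i))) where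

  ≈⇒eval-≡ : ∀ {a b} → Γ ∣ a ≈ b → eval ρ a ≡ eval ρ b
  ≈⇒eval-≡ refl≈             = refl
  ≈⇒eval-≡ (sym≈ p)          = sym (≈⇒eval-≡ p)
  ≈⇒eval-≡ (trans≈ p q)      = trans (≈⇒eval-≡ p) (≈⇒eval-≡ q)
  ≈⇒eval-≡ (⊕-cong p q)      = cong₂ _∨_ (≈⇒eval-≡ p) (≈⇒eval-≡ q)
  ≈⇒eval-≡ (⊙-cong p q)      = cong₂ _∧_ (≈⇒eval-≡ p) (≈⇒eval-≡ q)
  ≈⇒eval-≡ (ᶜ-cong p)        = cong not (≈⇒eval-≡ p)
  ≈⇒eval-≡ (⊕-assoc a b c)   = ∨-assoc (eval ρ a) (eval ρ b) (eval ρ c)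
  ≈⇒eval-≡ (⊕-comm a b)      = ∨-comm (eval ρ a) (eval ρ b)
  ≈⇒eval-≡ (⊕-idˡ a)         = refl
  ≈⇒eval-≡ (⊙-assoc a b c)   = ∧-assoc (eval ρ a) (eval ρ b) (eval ρ c)
  ≈⇒eval-≡ (⊙-comm a b)      = ∧-comm (eval ρ a) (eval ρ b)
  ≈⇒eval-≡ (⊙-idˡ a)         = refl
  ≈⇒eval-≡ (distribˡ a b c)  = ∧-distribˡ-∨ (eval ρ a) (eval ρ b) (eval ρ c)
  ≈⇒eval-≡ (zeroˡ a)         = refl
  ≈⇒eval-≡ (⊙-compl a)       = ∧-inverseʳ (eval ρ a)
  ≈⇒eval-≡ (⊕-compl a)       = ∨-inverseʳ (eval ρ a)
  ≈⇒eval-≡ (⊙-idem a)        = ∧-idem (eval ρ a)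
  ≈⇒eval-≡ (⊕-idem a)        = ∨-idem (eval ρ a)
  ≈⇒eval-≡ (hyp i)           = Equivalence.to T-≡ (ρ⊨Γ i)

  ⊢⇒T-eval : ∀ {a} → Γ ⊢ a → T (eval ρ a)
  ⊢⇒T-eval Γ⊢a = subst T (sym (≈⇒eval-≡ Γ⊢a)) tt

module _ (k : ℕ) where

  T-eval-pow : ∀ l e → T (eval (digit k) (pow l e)) ⇔ inAexp l e k
  T-eval-pow l e0 = mk⇔ (λ _ → tt) (λ _ → tt)
  T-eval-pow l e1 = T-≡
  T-eval-pow l ec = T-not-≡

  T-eval-monoTerm : ∀ {N} off (U : Monomial N) → T (eval (digit k) (monoTerm off U)) ⇔ inMono off U k
  T-eval-monoTerm off []      = mk⇔ (λ _ → tt) (λ _ → tt)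
  T-eval-monoTerm off (e ∷ U) = (T-eval-pow off e ×-⇔ T-eval-monoTerm _ U) ⇔-∘ T-∧

  T-eval-⟦⟧ : ∀ {N} (α : Poly N) → T (eval (digit k) ⟦ α ⟧) ⇔ inAα α k
  T-eval-⟦⟧ []       = mk⇔ (λ ()) (λ ())
  T-eval-⟦⟧ (U ∷ Us) = (T-eval-monoTerm 0 U ⊎-⇔ T-eval-⟦⟧ Us) ⇔-∘ T-∨

corollary4p16 : (I : Set) (N : I → ℕ) (α : (i : I) → Poly (N i))
                (M : ℕ) (β : Poly M) →
                (λ i → ⟦ α i ⟧) ⊢ ⟦ β ⟧ →
                ∀ (k : ℕ) → (∀ i → inAα (α i) k) → inAα β k
corollary4p16 I N α M β Γ⊢β k k∈Aα =
  Equivalence.to (T-eval-⟦⟧ k β) (⊢⇒T-eval (digit k) k⊨Γ Γ⊢β)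
  where
  k⊨Γ : ∀ i → T (eval (digit k) ⟦ α i ⟧)
  k⊨Γ i = Equivalence.from (T-eval-⟦⟧ k (α i)) (k∈Aα i)
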